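{- Let $\mathcal{F} = (S,\Omega)$ be a finite many-sorted signature, let $\Pi$ be a finite set of forbidden patterns all of the form $\langle u,o,h\rangle$ with $u$ linear, and let $\langle l\rightarrow r, p\rangle$ be a positioned rewrite rule. Then the set $T^*(\langle l\rightarrow r,p\rangle)$ of all many-step $T$-successors of $\langle l\rightarrow r,p\rangle$ is finite (up to renaming of variables).
   Context: For each sort $s\in S$ let $\mathsf{top}_s$ be a fresh unary symbol of type $s\rightarrow s$. A positioned rule is a pair $\langle l\rightarrow r, p\rangle$ of a rewrite rule and a position. Define $RV_\Pi(l,p) = \{x\in Var(l) \mid \exists \langle u,o,h\rangle\in\Pi, q: \theta = mgu(u, l|_q)$ exists, $q.o = p$, $x\theta\notin V\}$. $T^i(\langle l\rightarrow r,p\rangle)$ is the set of all $\langle l\sigma\rightarrow r\sigma, p\rangle$ where $x\in RV_\Pi(l,p)$, $f\in\mathcal{F}$ with result sort $sort(x)$, $x\sigma = f(x_1,\dots,x_{ar(f)})$ with fresh variables and $y\sigma = y$ for $y\neq x$. $T^e(\langle l\rightarrow r,p\rangle)$ is the set of all $\langle C[l]\rightarrow C[r], i.p\rangle$ where $C = f(x_1,\dots,x_{i-1},\Box,x_{i+1},\dots,x_{ar(f)})$ (fresh variables) with $f \in \mathcal{F}\uplus\{\mathsf{top}_s\mid s\in S\}$ whose $i$-th argument sort is $sort(l)$, provided there exist $\langle u,o,h\rangle\in\Pi$, a position $q\neq\epsilon$ and $\theta$ with $u|_q\theta = l\theta$ and $o = q.p$. The one-step $T$-successors of $\rho$ are the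 elements of $T(\rho) = T^i(\rho)\uplus T^e(\rho)$; $T^*(\rho)$ is the set of elements reachable from $\rho$ by the reflexive-transitive closure of the one-step $T$-successor relation. -}

module Defs where

open import Data.Nat using (ℕ; zero; suc; _+_; _⊔_)
open import Data.Fin using (Fin; zero; suc; toℕ)
open import Data.List using (List; []; _∷_; _++_; length; lookup; map; foldr)
open import Data.List.Membership.Propositional using (_∈_; _∉_)
open import Data.List.Relation.Unary.All using (All)
open import Data.List.Relation.Unary.Unique.Propositional using (Unique)
open import Data.Maybe using (Maybe; just; nothing)
open import Data.Product using (Σ; ∃; _×_; _,_; proj₁; proj₂)
open import Data.Sum using (_⊎_)
open import Data.Empty using (⊥)
open import Data.Unit using (⊤)
open import Relation.Nullary using (¬_)
open import Relation.Binary.PropositionalEquality using (_≡_; _≢_; subst)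
open import Relation.Binary.Construct.Closure.ReflexiveTransitive using (Star)

record Signature : Set where
  field
    nSorts : ℕ
    nFuns  : ℕ
    args   : Fin nFuns → List (Fin nSorts)
    res    : Fin nFuns → Fin nSorts

module _ (F : Signature) where
  open Signature F

  Sort : Set
  Sort = Fin nSorts

  -- Symbols of F extended by the fresh unary symbols top_s : s → s
  data Sym : Set where
    fun : Fin nFuns → Sym
    top : Sort → Sym

  argsX : Sym → List Sort
  argsX (fun f) = args f
  argsX (top s) = s ∷ []

  resX : Sym → Sort
  resX (fun f) = res f
  resX (top s) = s

  Var : Set
  Var = Sort × ℕ

  data Term : Sort → Set
  data Terms : List Sort → Set

  data Term where
    var : (s : Sort) → ℕ → Term s
    app : (f : Sym) → Terms (argsX f) → Term (resX f)

  data Terms where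
    []  : Terms []
    _∷_ : ∀ {s ss} → Term s → Terms ss → Terms (s ∷ ss)

  STerm : Set
  STerm = Σ Sort Term

  IsVar : ∀ {s} → Term s → Set
  IsVar (var _ _) = ⊤
  IsVar (app _ _) = ⊥

  OverF  : ∀ {s} → Term s → Set
  OverFs : ∀ {ss} → Terms ss → Set
  OverF (var _ _) = ⊤
  OverF (app (fun f) ts) = OverFs ts
  OverF (app (top s) ts) = ⊥
  OverFs [] = ⊤
  OverFs (t ∷ ts) = OverF t × OverFs ts

  vars  : ∀ {s} → Term s → List Var
  varsS : ∀ {ss} → Terms ss → List Var
  vars (var s n) = (s , n) ∷ []
  vars (app f ts) = varsS ts
  varsS [] = []
  varsS (t ∷ ts) = vars t ++ varsS ts

  Linear : ∀ {s} → Term s → Set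
  Linear t = Unique (vars t)

  Subst : Set
  Subst = (s : Sort) → ℕ → Term s

  _⟨_⟩  : ∀ {s} → Term s → Subst → Term s
  _⟨_⟩s : ∀ {ss} → Terms ss → Subst → Terms ss
  var s n ⟨ σ ⟩ = σ s n
  app f ts ⟨ σ ⟩ = app f (ts ⟨ σ ⟩s)
  [] ⟨ σ ⟩s = []
  (t ∷ ts) ⟨ σ ⟩s = (t ⟨ σ ⟩) ∷ (ts ⟨ σ ⟩s)

  -- positions: lists of argument indices (0-based); ε = []
  Pos : Set
  Pos = List ℕ

  _∣_   : ∀ {s} → Term s → Pos → Maybe STerm
  argAt : ∀ {ss} → Terms ss → ℕ → Pos → Maybe STerm
  _∣_ {s} t [] = just (s , t)
  var _ _ ∣ (i ∷ q) = nothing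
  app f ts ∣ (i ∷ q) = argAt ts i q
  argAt [] i q = nothing
  argAt (t ∷ ts) zero q = t ∣ q
  argAt (t ∷ ts) (suc i) q = argAt ts i q

  Unifies : Subst → STerm → STerm → Set
  Unifies θ (s , a) (s′ , b) = _≡_ {A = STerm} (s , a ⟨ θ ⟩) (s′ , b ⟨ θ ⟩)

  IsMGU : Subst → STerm → STerm → Set
  IsMGU θ a b = Unifies θ a b ×
    ((σ : Subst) → Unifies σ a b → Σ Subst λ τ → ∀ s n → (θ s n) ⟨ τ ⟩ ≡ σ s n)

  shift : ℕ → ∀ {s} → Term s → Term s
  shift k t = t ⟨ (λ s n → var s (n + k)) ⟩

  maxName : ∀ {s} → Term s → ℕ
  maxName t = foldr _⊔_ 0 (map proj₂ (vars t))

  -- u renamed apart from l (variables of the result are disjoint from Var(l))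
  apart : ∀ {s s′} → Term s → Term s′ → Term s
  apart u l = shift (suc (maxName l)) u

  data Flag : Set where
    here above below : Flag

  record Pattern : Set where
    constructor ⟨_,_,_⟩
    field
      {psort} : Sort
      u : Term psort
      o : Pos
      h : Flag

  WFPattern : Pattern → Set
  WFPattern ⟨ u , o , h ⟩ = OverF u × (u ∣ o ≢ nothing)

  LinearPattern : Pattern → Set
  LinearPattern ⟨ u , o , h ⟩ = Linear u

  record PRule : Set where
    constructor ⟨_⟶_,_⟩
    field
      {rsort} : Sort
      lhs : Term rsort
      rhs : Term rsort
      pos : Pos

  IsRewriteRule : PRule → Set
  IsRewriteRule ⟨ l ⟶ r , p ⟩ =
    OverF l × OverF r × ¬ IsVar l × (∀ {x} → x ∈ vars r → x ∈ vars l)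

  module _ (Π : List Pattern) where

    RV : ∀ {s} → Term s → Pos → Var → Set
    RV l p x = x ∈ vars l × Σ Pattern λ π → π ∈ Π × Σ Pos λ q → Σ STerm λ lq →
      (l ∣ q ≡ just lq) × (q ++ Pattern.o π ≡ p) ×
      Σ Subst λ θ → IsMGU θ (_ , apart (Pattern.u π) l) lq ×
        ¬ IsVar (θ (proj₁ x) (proj₂ x))

    varArgs : (ss : List Sort) → (Fin (length ss) → ℕ) → Terms ss
    varArgs [] nm = []
    varArgs (s ∷ ss) nm = var s (nm zero) ∷ varArgs ss (λ j → nm (suc j))

    plug : (ss : List Sort) (i : Fin (length ss)) → (Fin (length ss) → ℕ) →
           Term (lookup ss i) → Terms ss
    plug (s ∷ ss) zero nm t = t ∷ varArgs ss (λ j → nm (suc j))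
    plug (s ∷ ss) (suc i) nm t = var s (nm zero) ∷ plug ss i (λ j → nm (suc j)) t

    Ti : PRule → PRule → Set
    Ti ⟨ l ⟶ r , p ⟩ ρ′ =
      Σ Var λ x → RV l p x ×
      Σ (Fin (Signature.nFuns F)) λ f → Σ (res f ≡ proj₁ x) λ _ →
      Σ (Fin (length (args f)) → ℕ) λ nm →
        (∀ j k → nm j ≡ nm k → j ≡ k) ×
        (∀ j → (lookup (args f) j , nm j) ∉ vars l ++ vars r) ×
      Σ Subst λ σ →
        (_≡_ {A = STerm} (proj₁ x , σ (proj₁ x) (proj₂ x))
                         (res f , app (fun f) (varArgs (args f) nm))) ×
        (∀ s n → (s , n) ≢ x → σ s n ≡ var s n) ×
        ρ′ ≡ ⟨ l ⟨ σ ⟩ ⟶ r ⟨ σ ⟩ , p ⟩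

    Te : PRule → PRule → Set
    Te (⟨_⟶_,_⟩ {s} l r p) ρ′ =
      (Σ Pattern λ π → π ∈ Π × Σ Pos λ q → q ≢ [] × Σ STerm λ uq →
        (apart (Pattern.u π) l ∣ q ≡ just uq) × Σ Subst λ θ →
        Unifies θ uq (s , l) × Pattern.o π ≡ q ++ p) ×
      Σ Sym λ f → Σ (Fin (length (argsX f))) λ i →
      Σ (s ≡ lookup (argsX f) i) λ eq →
      Σ (Fin (length (argsX f)) → ℕ) λ nm →
        (∀ j k → j ≢ i → k ≢ i → nm j ≡ nm k → j ≡ k) ×
        (∀ j → j ≢ i → (lookup (argsX f) j , nm j) ∉ vars l ++ vars r) ×
        ρ′ ≡ ⟨ app f (plug (argsX f) i nm (subst Term eq l))
             ⟶ app f (plug (argsX f) i nm (subst Term eq r))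
             , toℕ i ∷ p ⟩

    TStep : PRule → PRule → Set
    TStep ρ ρ′ = Ti ρ ρ′ ⊎ Te ρ ρ′

    TStar : PRule → PRule → Set
    TStar = Star TStep

  Variant : PRule → PRule → Set
  Variant ⟨ l ⟶ r , p ⟩ ⟨ l′ ⟶ r′ , p′ ⟩ =
    Σ (Sort → ℕ → ℕ) λ ren → Σ (Sort → ℕ → ℕ) λ ren⁻ →
      (∀ s n → ren⁻ s (ren s n) ≡ n) × (∀ s n → ren s (ren⁻ s n) ≡ n) ×
      _≡_ {A = STerm} (_ , l ⟨ (λ s n → var s (ren s n)) ⟩) (_ , l′) ×
      _≡_ {A = STerm} (_ , r ⟨ (λ s n → var s (ren s n)) ⟩) (_ , r′) ×
      p ≡ p′

  FiniteUpToRenaming : (PRule → Set) → Set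
  FiniteUpToRenaming P =
    Σ (List PRule) λ L → ∀ ρ → P ρ → Σ PRule λ ρ′ → ρ′ ∈ L × Variant ρ ρ′

-- The successors of ⟨ l → r , p ⟩ are confined to a finite family of shapes.
-- A T^e step pushes the rule one level down a context, and the positioned
-- pattern that licenses it forces |p| < |o|, so at most max |o| such steps
-- happen and each adds a single argument index, bounded by the maximal arity.
-- A T^i step instantiates a variable x ∈ RV_Π(l , p); because the pattern u is
-- linear, θ = mgu(u , l|_q) can only bind x to a non-variable term if x occurs
-- in l|_q strictly below a function symbol of u, hence at depth < |p| + depth u
-- in l. Every variable occurs in l and r at depths differing by at most the
-- initial depth d₀ (fresh variables are introduced at a single depth), so each
-- step keeps the depth of both sides below |p| + max (depth u) + d₀. Terms of
-- bounded depth over a finite signature have boundedly many variable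
-- occurrences; renaming their variables into an initial segment of ℕ leaves
-- finitely many rules.

module Submission where

open import Defs
open import Data.Nat using (ℕ; zero; suc; _+_; _*_; _^_; _⊔_; _≤_; _<_; z≤n; s≤s)
import Data.Nat as ℕ
open import Data.Nat.Properties
open import Data.Fin using (Fin; zero; suc)
import Data.Fin as Fin
open import Data.Fin.Properties using (toℕ<n)
open import Data.List
  using (List; []; _∷_; _++_; length; lookup; map; foldr; allFin; concatMap; upTo; cartesianProductWith)
open import Data.List.Properties using (length-++; length-map; map-++)
open import Data.List.Membership.Propositional using (_∈_; _∉_; lose)
open import Data.List.Membership.Propositional.Properties
open import Data.List.Relation.Unary.Any using (here; there)
open import Data.List.Relation.Unary.All using (All; []; _∷_)
import Data.List.Relation.Unary.All as All
import Data.List.Relation.Unary.All.Properties as All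
open import Data.List.Relation.Unary.Unique.Propositional using (Unique; []; _∷_)
import Data.List.Relation.Unary.Unique.Propositional.Properties as Unique
open import Data.Maybe using (just)
open import Data.Product using (Σ; ∃; _×_; _,_; proj₁; proj₂)
open import Data.Product.Properties using (≡-dec)
open import Data.Sum using (_⊎_; inj₁; inj₂)
open import Data.Empty using (⊥-elim)
open import Data.Unit using (tt)
open import Function using (_∘_)
open import Function.Bundles using (_↔_; Inverse; mk↔ₛ′)
open import Function.Construct.Composition using (_↔-∘_)
open import Function.Construct.Identity using (↔-id)
open import Relation.Nullary using (¬_; Dec; yes; no)
open import Relation.Binary.PropositionalEquality
open import Relation.Binary.Construct.Closure.ReflexiveTransitive using (ε; _◅_)

Unique-++⁻ : ∀ {A : Set} (xs : List A) {ys : List A} → Unique (xs ++ ys) →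
             Unique xs × Unique ys × (∀ {v} → v ∈ xs → v ∉ ys)
Unique-++⁻ [] ys! = [] , ys! , λ ()
Unique-++⁻ (x ∷ xs) (x∉ ∷ xs!) with Unique-++⁻ xs xs!
... | xs!′ , ys! , disjoint =
  All.++⁻ˡ xs x∉ ∷ xs!′ , ys! ,
  λ { (here refl) v∈ys → All.lookup (All.++⁻ʳ xs x∉) v∈ys refl
    ; (there v∈xs) → disjoint v∈xs }

≤-foldr-⊔ : ∀ {n} ns → n ∈ ns → n ≤ foldr _⊔_ 0 ns
≤-foldr-⊔ (m ∷ ns) (here refl) = m≤m⊔n m _
≤-foldr-⊔ (m ∷ ns) (there n∈ns) = ≤-trans (≤-foldr-⊔ ns n∈ns) (m≤n⊔m m _)

≤-max-map : ∀ {A : Set} (g : A → ℕ) {xs x} → x ∈ xs → g x ≤ foldr _⊔_ 0 (map g xs)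
≤-max-map g {xs} x∈xs = ≤-foldr-⊔ (map g xs) (∈-map⁺ g x∈xs)

∈-concatMap-intro : ∀ {A B : Set} {f : A → List B} {xs x y} → x ∈ xs → y ∈ f x → y ∈ concatMap f xs
∈-concatMap-intro {f = f} x∈xs y∈fx = ∈-concatMap⁺ f (lose x∈xs y∈fx)

transpose : ℕ → ℕ → ℕ → ℕ
transpose a b n with n ℕ.≟ a | n ℕ.≟ b
... | yes _ | _     = b
... | no _  | yes _ = a
... | no _  | no _  = n

transpose-ˡ : ∀ a b → transpose a b a ≡ b
transpose-ˡ a b with a ℕ.≟ a
... | yes _ = refl
... | no a≢a = ⊥-elim (a≢a refl)

transpose-ʳ : ∀ a b → transpose a b b ≡ a
transpose-ʳ a b with b ℕ.≟ a | b ℕ.≟ b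
... | yes refl | _ = refl
... | no _ | yes _ = refl
... | no _ | no b≢b = ⊥-elim (b≢b refl)

transpose-other : ∀ a b n → n ≢ a → n ≢ b → transpose a b n ≡ n
transpose-other a b n n≢a n≢b with n ℕ.≟ a | n ℕ.≟ b
... | yes n≡a | _ = ⊥-elim (n≢a n≡a)
... | no _ | yes n≡b = ⊥-elim (n≢b n≡b)
... | no _ | no _ = refl

transpose-involutive : ∀ a b n → transpose a b (transpose a b n) ≡ n
transpose-involutive a b n with n ℕ.≟ a | n ℕ.≟ b
... | yes refl | _ = transpose-ʳ n b
... | no _ | yes refl = transpose-ˡ a n
... | no n≢a | no n≢b = transpose-other a b n n≢a n≢b

transpose↔ : ℕ → ℕ → ℕ ↔ ℕ
transpose↔ a b = mk↔ₛ′ (transpose a b) (transpose a b) (transpose-involutive a b) (transpose-involutive a b)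

-- Induction on xs: if the new name lands outside the segment, swap it with |xs|.
compress-names : (xs : List ℕ) → Σ (ℕ ↔ ℕ) λ π → ∀ {n} → n ∈ xs → Inverse.to π n < length xs
compress-names [] = ↔-id ℕ , λ ()
compress-names (x ∷ xs) with compress-names xs
... | π , π-below with Inverse.to π x ℕ.<? suc (length xs)
...   | yes πx< = π , λ { (here refl) → πx< ; (there n∈xs) → m<n⇒m<1+n (π-below n∈xs) }
...   | no πx≮ = transpose↔ k (Inverse.to π x) ↔-∘ π , lands-below
  where
    k = length xs
    lands-below : ∀ {n} → n ∈ x ∷ xs → transpose k (Inverse.to π x) (Inverse.to π n) < suc k
    lands-below (here refl) = ≤-reflexive (cong suc (transpose-ʳ k (Inverse.to π x)))
    lands-below {n} (there n∈xs) =
      subst (_< suc k)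
        (sym (transpose-other k _ _ (<⇒≢ (π-below n∈xs))
               (λ πn≡πx → πx≮ (m<n⇒m<1+n (subst (_< k) πn≡πx (π-below n∈xs))))))
        (m<n⇒m<1+n (π-below n∈xs))

lists-below : ℕ → ℕ → List (List ℕ)
lists-below A zero = [] ∷ []
lists-below A (suc P) = [] ∷ cartesianProductWith _∷_ (upTo A) (lists-below A P)

∈-lists-below : ∀ A P (ks : List ℕ) → length ks ≤ P → All (_< A) ks → ks ∈ lists-below A P
∈-lists-below A zero [] _ _ = here refl
∈-lists-below A (suc P) [] _ _ = here refl
∈-lists-below A (suc P) (k ∷ ks) (s≤s len≤) (k<A ∷ ks<A) =
  there (∈-cartesianProductWith⁺ _∷_ (∈-upTo⁺ k<A) (∈-lists-below A P ks len≤ ks<A))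

module _ (F : Signature) where
  open Signature F

  infixl 8 _⟪_⟫ _⟪_⟫s
  infix 4 _≅_ _≅s_

  _⟪_⟫ : ∀ {s} → Term F s → Subst F → Term F s
  _⟪_⟫ = _⟨_⟩ F

  _⟪_⟫s : ∀ {ss} → Terms F ss → Subst F → Terms F ss
  _⟪_⟫s = _⟨_⟩s F

  _≅_ : ∀ {s s′} → Term F s → Term F s′ → Set
  u ≅ t = _≡_ {A = STerm F} (_ , u) (_ , t)

  _≅s_ : ∀ {ss ss′} → Terms F ss → Terms F ss′ → Set
  us ≅s ts = _≡_ {A = Σ (List (Sort F)) (Terms F)} (_ , us) (_ , ts)

  app-injective : ∀ {f g us ts} → app f us ≅ app g ts → Σ (f ≡ g) λ { refl → us ≡ ts }
  app-injective refl = refl , refl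

  app-cong : ∀ f {us ts : Terms F (argsX F f)} → us ≅s ts → app f us ≅ app f ts
  app-cong f refl = refl

  ∷-injective : ∀ {s s′ ss ss′} {u : Term F s} {t : Term F s′} {us : Terms F ss} {ts : Terms F ss′} →
                u ∷ us ≅s t ∷ ts → u ≅ t × us ≅s ts
  ∷-injective refl = refl , refl

  ∷-cong : ∀ {s s′ ss ss′} {u : Term F s} {t : Term F s′} {us : Terms F ss} {ts : Terms F ss′} →
           u ≅ t → us ≅s ts → u ∷ us ≅s t ∷ ts
  ∷-cong refl refl = refl

  _≟ᵛ_ : (x y : Var F) → Dec (x ≡ y)
  _≟ᵛ_ = ≡-dec Fin._≟_ ℕ._≟_

  depth : ∀ {s} → Term F s → ℕ
  depths : ∀ {ss} → Terms F ss → ℕ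
  depth (var _ _) = 0
  depth (app f ts) = suc (depths ts)
  depths [] = 0
  depths (t ∷ ts) = depth t ⊔ depths ts

  data Occ : Var F → ∀ {s} → Term F s → ℕ → Set
  data Occs : Var F → ∀ {ss} → Terms F ss → ℕ → Set
  data Occ where
    at-var : ∀ {s n} → Occ (s , n) (var s n) 0
    in-app : ∀ {x f ts d} → Occs x ts d → Occ x (app f ts) (suc d)
  data Occs where
    in-head : ∀ {x s ss} {t : Term F s} {ts : Terms F ss} {d} → Occ x t d → Occs x (t ∷ ts) d
    in-tail : ∀ {x s ss} {t : Term F s} {ts : Terms F ss} {d} → Occs x ts d → Occs x (t ∷ ts) d

  ∈-vars⇒Occ : ∀ {x s} (t : Term F s) → x ∈ vars F t → ∃ (Occ x t)
  ∈-varsS⇒Occs : ∀ {x ss} (ts : Terms F ss) → x ∈ varsS F ts → ∃ (Occs x ts)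
  ∈-vars⇒Occ (var s n) (here refl) = 0 , at-var
  ∈-vars⇒Occ (app f ts) x∈ = let d , occ = ∈-varsS⇒Occs ts x∈ in suc d , in-app occ
  ∈-varsS⇒Occs (t ∷ ts) x∈ with ∈-++⁻ (vars F t) x∈
  ... | inj₁ x∈t = let d , occ = ∈-vars⇒Occ t x∈t in d , in-head occ
  ... | inj₂ x∈ts = let d , occ = ∈-varsS⇒Occs ts x∈ts in d , in-tail occ

  Occ⇒∈-vars : ∀ {x s} {t : Term F s} {d} → Occ x t d → x ∈ vars F t
  Occs⇒∈-varsS : ∀ {x ss} {ts : Terms F ss} {d} → Occs x ts d → x ∈ varsS F ts
  Occ⇒∈-vars at-var = here refl
  Occ⇒∈-vars (in-app occ) = Occs⇒∈-varsS occ
  Occs⇒∈-varsS (in-head occ) = ∈-++⁺ˡ (Occ⇒∈-vars occ)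
  Occs⇒∈-varsS (in-tail {t = t} occ) = ∈-++⁺ʳ (vars F t) (Occs⇒∈-varsS occ)

  Occ⇒≤depth : ∀ {x s} {t : Term F s} {d} → Occ x t d → d ≤ depth t
  Occs⇒≤depths : ∀ {x ss} {ts : Terms F ss} {d} → Occs x ts d → d ≤ depths ts
  Occ⇒≤depth at-var = z≤n
  Occ⇒≤depth (in-app occ) = s≤s (Occs⇒≤depths occ)
  Occs⇒≤depths (in-head {ts = ts} occ) = ≤-trans (Occ⇒≤depth occ) (m≤m⊔n _ (depths ts))
  Occs⇒≤depths (in-tail {t = t} occ) = ≤-trans (Occs⇒≤depths occ) (m≤n⊔m (depth t) _)

  Occ-var⁻ : ∀ {y s n d} → Occ y (var s n) d → y ≡ (s , n) × d ≡ 0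
  Occ-var⁻ at-var = refl , refl

  ⟪⟫-cong : ∀ {s} (t : Term F s) {σ τ : Subst F} →
            (∀ {s′ n d} → Occ (s′ , n) t d → σ s′ n ≡ τ s′ n) → t ⟪ σ ⟫ ≡ t ⟪ τ ⟫
  ⟪⟫s-cong : ∀ {ss} (ts : Terms F ss) {σ τ : Subst F} →
             (∀ {s′ n d} → Occs (s′ , n) ts d → σ s′ n ≡ τ s′ n) → ts ⟪ σ ⟫s ≡ ts ⟪ τ ⟫s
  ⟪⟫-cong (var s n) σ≗τ = σ≗τ at-var
  ⟪⟫-cong (app f ts) σ≗τ = cong (app f) (⟪⟫s-cong ts (λ occ → σ≗τ (in-app occ)))
  ⟪⟫s-cong [] σ≗τ = refl
  ⟪⟫s-cong (t ∷ ts) σ≗τ =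
    cong₂ _∷_ (⟪⟫-cong t (λ occ → σ≗τ (in-head occ))) (⟪⟫s-cong ts (λ occ → σ≗τ (in-tail occ)))

  Occ-⟪⟫⁻ : ∀ {s} (t : Term F s) {σ : Subst F} {y c} → Occ y (t ⟪ σ ⟫) c →
            Σ (Var F) λ (s′ , n) → Σ ℕ λ a → Σ ℕ λ b →
              Occ (s′ , n) t a × Occ y (σ s′ n) b × c ≡ a + b
  Occs-⟪⟫s⁻ : ∀ {ss} (ts : Terms F ss) {σ : Subst F} {y c} → Occs y (ts ⟪ σ ⟫s) c →
              Σ (Var F) λ (s′ , n) → Σ ℕ λ a → Σ ℕ λ b →
                Occs (s′ , n) ts a × Occ y (σ s′ n) b × c ≡ a + b
  Occ-⟪⟫⁻ (var s n) occ = (s , n) , 0 , _ , at-var , occ , refl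
  Occ-⟪⟫⁻ (app f ts) (in-app occ) with Occs-⟪⟫s⁻ ts occ
  ... | x , a , b , occ₁ , occ₂ , c≡ = x , suc a , b , in-app occ₁ , occ₂ , cong suc c≡
  Occs-⟪⟫s⁻ (t ∷ ts) (in-head occ) with Occ-⟪⟫⁻ t occ
  ... | x , a , b , occ₁ , occ₂ , c≡ = x , a , b , in-head occ₁ , occ₂ , c≡
  Occs-⟪⟫s⁻ (t ∷ ts) (in-tail occ) with Occs-⟪⟫s⁻ ts occ
  ... | x , a , b , occ₁ , occ₂ , c≡ = x , a , b , in-tail occ₁ , occ₂ , c≡

  depth-⟪⟫-≤ : ∀ {s} (t : Term F s) {σ : Subst F} K → depth t ≤ K →
               (∀ {s′ n a} → Occ (s′ , n) t a → a + depth (σ s′ n) ≤ K) → depth (t ⟪ σ ⟫) ≤ K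
  depths-⟪⟫s-< : ∀ {ss} (ts : Terms F ss) {σ : Subst F} K → depths ts < K →
                 (∀ {s′ n a} → Occs (s′ , n) ts a → suc a + depth (σ s′ n) ≤ K) →
                 depths (ts ⟪ σ ⟫s) < K
  depth-⟪⟫-≤ (var s n) K _ bound = bound at-var
  depth-⟪⟫-≤ (app f ts) K d< bound = depths-⟪⟫s-< ts K d< (λ occ → bound (in-app occ))
  depths-⟪⟫s-< [] K d< bound = d<
  depths-⟪⟫s-< (t ∷ ts) (suc K) (s≤s d≤) bound =
    s≤s (⊔-lub (depth-⟪⟫-≤ t K (≤-trans (m≤m⊔n _ _) d≤) (λ occ → ≤-pred (bound (in-head occ))))
               (≤-pred (depths-⟪⟫s-< ts (suc K) (s≤s (≤-trans (m≤n⊔m (depth t) _) d≤))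
                                      (λ occ → bound (in-tail occ)))))

  ⟪⟫≡var⇒var : ∀ {s} (t : Term F s) {σ : Subst F} {n} → t ⟪ σ ⟫ ≡ var s n → IsVar F t
  ⟪⟫≡var⇒var (var _ _) _ = tt
  ⟪⟫≡var⇒var (app _ _) ()

  Renaming : Set
  Renaming = Sort F → ℕ → ℕ

  ren : Renaming → Subst F
  ren ρ s n = var s (ρ s n)

  depth-ren : ∀ {s} (t : Term F s) ρ → depth (t ⟪ ren ρ ⟫) ≡ depth t
  depths-ren : ∀ {ss} (ts : Terms F ss) ρ → depths (ts ⟪ ren ρ ⟫s) ≡ depths ts
  depth-ren (var s n) ρ = refl
  depth-ren (app f ts) ρ = cong suc (depths-ren ts ρ)
  depths-ren [] ρ = refl
  depths-ren (t ∷ ts) ρ = cong₂ _⊔_ (depth-ren t ρ) (depths-ren ts ρ)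

  update : (s : Sort F) (n : ℕ) → Term F s → Subst F → Subst F
  update s n t σ s′ n′ with s′ Fin.≟ s | n′ ℕ.≟ n
  ... | yes refl | yes refl = t
  ... | _ | _ = σ s′ n′

  update-≡ : ∀ s n t σ → update s n t σ s n ≡ t
  update-≡ s n t σ with s Fin.≟ s | n ℕ.≟ n
  ... | yes refl | yes refl = refl
  ... | no s≢s | _ = ⊥-elim (s≢s refl)
  ... | yes refl | no n≢n = ⊥-elim (n≢n refl)

  open import Data.List.Membership.DecPropositional _≟ᵛ_ using (_∈?_)

  combine : List (Var F) → Subst F → Subst F → Subst F
  combine xs σ τ s n with (s , n) ∈? xs
  ... | yes _ = σ s n
  ... | no _ = τ s n

  combine-∈ : ∀ {xs σ τ s n} → (s , n) ∈ xs → combine xs σ τ s n ≡ σ s n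
  combine-∈ {xs} {s = s} {n} x∈ with (s , n) ∈? xs
  ... | yes _ = refl
  ... | no x∉ = ⊥-elim (x∉ x∈)

  combine-∉ : ∀ {xs σ τ s n} → (s , n) ∉ xs → combine xs σ τ s n ≡ τ s n
  combine-∉ {xs} {s = s} {n} x∉ with (s , n) ∈? xs
  ... | yes x∈ = ⊥-elim (x∉ x∈)
  ... | no _ = refl

  ⟪combine⟫-⊆ : ∀ {s} (t : Term F s) {xs σ τ} → (∀ {y} → y ∈ vars F t → y ∈ xs) →
                t ⟪ combine xs σ τ ⟫ ≡ t ⟪ σ ⟫
  ⟪combine⟫-⊆ t t⊆xs = ⟪⟫-cong t (λ occ → combine-∈ (t⊆xs (Occ⇒∈-vars occ)))

  ⟪combine⟫-disjoint : ∀ {s} (t : Term F s) {xs σ τ} → (∀ {y} → y ∈ vars F t → y ∉ xs) →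
                       t ⟪ combine xs σ τ ⟫ ≡ t ⟪ τ ⟫
  ⟪combine⟫-disjoint t t#xs = ⟪⟫-cong t (λ occ → combine-∉ (t#xs (Occ⇒∈-vars occ)))

  ⟪combine⟫s-disjoint : ∀ {ss} (ts : Terms F ss) {xs σ τ} → (∀ {y} → y ∈ varsS F ts → y ∉ xs) →
                        ts ⟪ combine xs σ τ ⟫s ≡ ts ⟪ τ ⟫s
  ⟪combine⟫s-disjoint ts ts#xs = ⟪⟫s-cong ts (λ occ → combine-∉ (ts#xs (Occs⇒∈-varsS occ)))

  module Skeleton (x : Var F) (θ : Subst F) where

    θ[x↦x] : Subst F
    θ[x↦x] s n with (s , n) ≟ᵛ x
    ... | yes _ = var s n
    ... | no _ = θ s n

    θ[x↦x]-x : θ[x↦x] (proj₁ x) (proj₂ x) ≡ var (proj₁ x) (proj₂ x)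
    θ[x↦x]-x with x ≟ᵛ x
    ... | yes _ = refl
    ... | no x≢x = ⊥-elim (x≢x refl)

    θ[x↦x]-≢ : ∀ {s n} → (s , n) ≢ x → θ[x↦x] s n ≡ θ s n
    θ[x↦x]-≢ {s} {n} y≢x with (s , n) ≟ᵛ x
    ... | yes y≡x = ⊥-elim (y≢x y≡x)
    ... | no _ = refl

    OccBelow : ∀ {s s′} → Term F s → Term F s′ → Set
    OccBelow u t = ∃ λ b → Occ x t b × b < depth u

    OccsBelow : ∀ {ss ss′} → Terms F ss → Terms F ss′ → Set
    OccsBelow us ts = ∃ λ b → Occs x ts b × b < depths us

    -- Linearity of u lets the solutions found for the argument pairs be combined.
    occBelow-or-solvable : ∀ {s s′} (u : Term F s) (t : Term F s′) → Linear F u → u ⟪ θ ⟫ ≅ t ⟪ θ ⟫ →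
                           OccBelow u t ⊎ Σ (Subst F) λ σ → u ⟪ σ ⟫ ≅ t ⟪ θ[x↦x] ⟫
    occsBelow-or-solvable : ∀ {ss ss′} (us : Terms F ss) (ts : Terms F ss′) → Unique (varsS F us) →
                            us ⟪ θ ⟫s ≅s ts ⟪ θ ⟫s →
                            OccsBelow us ts ⊎ Σ (Subst F) λ σ → us ⟪ σ ⟫s ≅s ts ⟪ θ[x↦x] ⟫s
    occBelow-or-solvable (var s n) t lin uθ≅tθ with cong proj₁ uθ≅tθ
    ... | refl = inj₂ (update s n (t ⟪ θ[x↦x] ⟫) θ , cong (s ,_) (update-≡ s n _ θ))
    occBelow-or-solvable (app f us) (var s′ m) lin uθ≅tθ with x ≟ᵛ (s′ , m)
    ... | yes refl = inj₁ (0 , at-var , s≤s z≤n)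
    ... | no x≢y = inj₂ (θ , trans uθ≅tθ (cong (s′ ,_) (sym (θ[x↦x]-≢ (x≢y ∘ sym)))))
    occBelow-or-solvable (app f us) (app g ts) lin uθ≅tθ with app-injective uθ≅tθ
    ... | refl , usθ≡tsθ with occsBelow-or-solvable us ts lin (cong (argsX F f ,_) usθ≡tsθ)
    ...   | inj₁ (b , occ , b<) = inj₁ (suc b , in-app occ , s≤s b<)
    ...   | inj₂ (σ , solved) = inj₂ (σ , app-cong f solved)
    occsBelow-or-solvable [] [] lin _ = inj₂ (θ , refl)
    occsBelow-or-solvable (u ∷ us) (t ∷ ts) lin uθ≅tθ
      with Unique-++⁻ (vars F u) lin | ∷-injective uθ≅tθ
    ... | lin-u , lin-us , disjoint | e , es with occBelow-or-solvable u t lin-u e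
    ...   | inj₁ (b , occ , b<) = inj₁ (b , in-head occ , ≤-trans b< (m≤m⊔n _ _))
    ...   | inj₂ (σ , solved) with occsBelow-or-solvable us ts lin-us es
    ...     | inj₁ (b , occ , b<) = inj₁ (b , in-tail occ , ≤-trans b< (m≤n⊔m (depth u) _))
    ...     | inj₂ (σs , solveds) =
      inj₂ (combine (vars F u) σ σs ,
            ∷-cong (trans (cong (_ ,_) (⟪combine⟫-⊆ u (λ y∈u → y∈u))) solved)
                   (trans (cong (_ ,_) (⟪combine⟫s-disjoint us (λ y∈us y∈u → disjoint y∈u y∈us))) solveds))

    -- The unifier combine (vars u) σ θ[x↦x] keeps x a variable, so the mgu θ must too.
    mgu-binds⇒occBelow : ∀ {s s′} (u : Term F s) (t : Term F s′) → Linear F u →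
                         (∀ {y} → y ∈ vars F t → y ∉ vars F u) → x ∉ vars F u →
                         IsMGU F θ (s , u) (s′ , t) → ¬ IsVar F (θ (proj₁ x) (proj₂ x)) → OccBelow u t
    mgu-binds⇒occBelow u t lin disjoint x∉u (unifies , most-general) θx-nonvar
      with occBelow-or-solvable u t lin unifies
    ... | inj₁ occBelow = occBelow
    ... | inj₂ (σ , solved) = ⊥-elim (θx-nonvar (⟪⟫≡var⇒var (θ (proj₁ x) (proj₂ x)) θx⟪τ⟫≡x))
      where
        σ′ : Subst F
        σ′ = combine (vars F u) σ θ[x↦x]
        σ′-unifies : Unifies F σ′ (_ , u) (_ , t)
        σ′-unifies = trans (cong (_ ,_) (⟪combine⟫-⊆ u (λ y∈u → y∈u)))
                     (trans solved (cong (_ ,_) (sym (⟪combine⟫-disjoint t disjoint))))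
        factor : Σ (Subst F) λ τ → ∀ s n → θ s n ⟪ τ ⟫ ≡ σ′ s n
        factor = most-general σ′ σ′-unifies
        θx⟪τ⟫≡x : θ (proj₁ x) (proj₂ x) ⟪ proj₁ factor ⟫ ≡ var (proj₁ x) (proj₂ x)
        θx⟪τ⟫≡x = trans (proj₂ factor (proj₁ x) (proj₂ x)) (trans (combine-∉ x∉u) θ[x↦x]-x)

  Occ-∣ : ∀ {s} (l : Term F s) q {s′ lq y b} → _∣_ F l q ≡ just (s′ , lq) → Occ y lq b →
          Occ y l (length q + b)
  Occs-argAt : ∀ {ss} (ts : Terms F ss) i q {s′ lq y b} → argAt F ts i q ≡ just (s′ , lq) → Occ y lq b →
               Occs y ts (length q + b)
  Occ-∣ l [] refl occ = occ
  Occ-∣ (app f ts) (i ∷ q) at≡ occ = in-app (Occs-argAt ts i q at≡ occ)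
  Occs-argAt (t ∷ ts) zero q at≡ occ = in-head (Occ-∣ t q at≡ occ)
  Occs-argAt (t ∷ ts) (suc i) q at≡ occ = in-tail (Occs-argAt ts i q at≡ occ)

  shiftVar : ℕ → Var F → Var F
  shiftVar k (s , n) = s , n + k

  vars-shift : ∀ {s} k (u : Term F s) → vars F (shift F k u) ≡ map (shiftVar k) (vars F u)
  varsS-shift : ∀ {ss} k (us : Terms F ss) →
                varsS F (us ⟪ ren (λ _ n → n + k) ⟫s) ≡ map (shiftVar k) (varsS F us)
  vars-shift k (var s n) = refl
  vars-shift k (app f ts) = varsS-shift k ts
  varsS-shift k [] = refl
  varsS-shift k (t ∷ ts) =
    trans (cong₂ _++_ (vars-shift k t) (varsS-shift k ts)) (sym (map-++ (shiftVar k) (vars F t) _))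

  apart-disjoint : ∀ {s s′} (u : Term F s) (l : Term F s′) {y} → y ∈ vars F l → y ∉ vars F (apart F u l)
  apart-disjoint u l y∈l y∈u′ with ∈-map⁻ (shiftVar _) (subst (_ ∈_) (vars-shift _ u) y∈u′)
  ... | (s , n) , _ , refl =
    <⇒≱ (s≤s (≤-max-map proj₂ y∈l)) (m≤n+m (suc (maxName F l)) n)

  apart-linear : ∀ {s s′} (u : Term F s) (l : Term F s′) → Linear F u → Linear F (apart F u l)
  apart-linear u l lin = subst Unique (sym (vars-shift _ u)) (Unique.map⁺ shiftVar-injective lin)
    where
      shiftVar-injective : ∀ {x y} → shiftVar _ x ≡ shiftVar _ y → x ≡ y
      shiftVar-injective {s , n} {s′ , n′} eq with cong proj₁ eq
      ... | refl = cong (s ,_) (+-cancelʳ-≡ _ n n′ (cong proj₂ eq))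

  symbols : List (Sym F)
  symbols = map fun (allFin nFuns) ++ map top (allFin nSorts)

  ∈-symbols : ∀ f → f ∈ symbols
  ∈-symbols (fun f) = ∈-++⁺ˡ (∈-map⁺ fun (∈-allFin f))
  ∈-symbols (top s) = ∈-++⁺ʳ (map fun (allFin nFuns)) (∈-map⁺ top (∈-allFin s))

  module Enumeration (N : ℕ) where

    terms : ℕ → (s : Sort F) → List (Term F s)
    termss : ℕ → (ss : List (Sort F)) → List (Terms F ss)
    appsOfSort : ℕ → (s : Sort F) → Sym F → List (Term F s)
    terms zero s = map (var s) (upTo N)
    terms (suc d) s = terms zero s ++ concatMap (appsOfSort d s) symbols
    appsOfSort d s f with resX F f Fin.≟ s
    ... | yes refl = map (app f) (termss d (argsX F f))
    ... | no _ = []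
    termss d [] = [] ∷ []
    termss d (s ∷ ss) = cartesianProductWith _∷_ (terms d s) (termss d ss)

    NamesBelow : ∀ {s} → Term F s → Set
    NamesBelow t = ∀ {y a} → Occ y t a → proj₂ y < N

    NamesBelowS : ∀ {ss} → Terms F ss → Set
    NamesBelowS ts = ∀ {y a} → Occs y ts a → proj₂ y < N

    ∈-terms : ∀ d {s} (t : Term F s) → depth t ≤ d → NamesBelow t → t ∈ terms d s
    ∈-termss : ∀ d {ss} (ts : Terms F ss) → depths ts ≤ d → NamesBelowS ts → ts ∈ termss d ss
    ∈-appsOfSort : ∀ d f (ts : Terms F (argsX F f)) → depths ts ≤ d → NamesBelowS ts →
                   app f ts ∈ appsOfSort d (resX F f) f
    ∈-terms zero (var s n) _ names< = ∈-map⁺ (var s) (∈-upTo⁺ (names< at-var))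
    ∈-terms (suc d) (var s n) _ names< = ∈-++⁺ˡ (∈-terms zero (var s n) z≤n names<)
    ∈-terms (suc d) (app f ts) (s≤s ts≤) names< =
      ∈-++⁺ʳ (terms zero (resX F f))
        (∈-concatMap-intro (∈-symbols f) (∈-appsOfSort d f ts ts≤ (λ occ → names< (in-app occ))))
    ∈-appsOfSort d f ts ts≤ names< with resX F f Fin.≟ resX F f
    ... | yes refl = ∈-map⁺ (app f) (∈-termss d ts ts≤ names<)
    ... | no s≢s = ⊥-elim (s≢s refl)
    ∈-termss d [] _ _ = here refl
    ∈-termss d (t ∷ ts) t∷ts≤ names< =
      ∈-cartesianProductWith⁺ _∷_
        (∈-terms d t (≤-trans (m≤m⊔n _ _) t∷ts≤) (λ occ → names< (in-head occ)))
        (∈-termss d ts (≤-trans (m≤n⊔m (depth t) _) t∷ts≤) (λ occ → names< (in-tail occ)))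

  module _ (Π : List (Pattern F)) where

    Occs-varArgs⁻ : ∀ ss nm {y a} → Occs y (varArgs F Π ss nm) a →
                    a ≡ 0 × Σ (Fin (length ss)) λ j → y ≡ (lookup ss j , nm j)
    Occs-varArgs⁻ (s ∷ ss) nm (in-head at-var) = refl , zero , refl
    Occs-varArgs⁻ (s ∷ ss) nm (in-tail occ) with Occs-varArgs⁻ ss (λ j → nm (suc j)) occ
    ... | a≡0 , j , y≡ = a≡0 , suc j , y≡

    depths-varArgs : ∀ ss nm → depths (varArgs F Π ss nm) ≡ 0
    depths-varArgs [] nm = refl
    depths-varArgs (s ∷ ss) nm = depths-varArgs ss (λ j → nm (suc j))

    Occs-plug⁻ : ∀ ss i nm (t : Term F (lookup ss i)) {y a} → Occs y (plug F Π ss i nm t) a →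
                 Occ y t a ⊎ (Σ (Fin (length ss)) λ j → j ≢ i × y ≡ (lookup ss j , nm j) × a ≡ 0)
    Occs-plug⁻ (s ∷ ss) zero nm t (in-head occ) = inj₁ occ
    Occs-plug⁻ (s ∷ ss) zero nm t (in-tail occ) with Occs-varArgs⁻ ss (λ j → nm (suc j)) occ
    ... | a≡0 , j , y≡ = inj₂ (suc j , (λ ()) , y≡ , a≡0)
    Occs-plug⁻ (s ∷ ss) (suc i) nm t (in-head at-var) = inj₂ (zero , (λ ()) , refl , refl)
    Occs-plug⁻ (s ∷ ss) (suc i) nm t (in-tail occ) with Occs-plug⁻ ss i (λ j → nm (suc j)) t occ
    ... | inj₁ occ′ = inj₁ occ′
    ... | inj₂ (j , j≢i , y≡ , a≡0) = inj₂ (suc j , (λ { refl → j≢i refl }) , y≡ , a≡0)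

    depths-plug-≤ : ∀ ss i nm (t : Term F (lookup ss i)) → depths (plug F Π ss i nm t) ≤ depth t
    depths-plug-≤ (s ∷ ss) zero nm t = ⊔-lub ≤-refl (≤-trans (≤-reflexive (depths-varArgs ss _)) z≤n)
    depths-plug-≤ (s ∷ ss) (suc i) nm t = ⊔-lub z≤n (depths-plug-≤ ss i _ t)

    module Bounds (linΠ : All (LinearPattern F) Π) {s₀ : Sort F} (l₀ r₀ : Term F s₀) (p₀ : Pos F) where

      patternDepth patternPosLength maxArity arityBound d₀ : ℕ
      patternDepth = foldr _⊔_ 0 (map (λ π → depth (Pattern.u π)) Π)
      patternPosLength = foldr _⊔_ 0 (map (λ π → length (Pattern.o π)) Π)
      maxArity = foldr _⊔_ 0 (map (λ f → length (args f)) (allFin nFuns))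
      arityBound = suc (1 ⊔ maxArity)
      d₀ = depth l₀ ⊔ depth r₀

      -- the 1 accounts for the unary symbols top_s
      arity<arityBound : ∀ f → length (argsX F f) < arityBound
      arity<arityBound (fun f) =
        s≤s (≤-trans (≤-max-map (λ f → length (args f)) (∈-allFin f)) (m≤n⊔m 1 maxArity))
      arity<arityBound (top s) = s≤s (m≤m⊔n 1 maxArity)

      depthBound : Pos F → ℕ
      depthBound p = length p + (patternDepth + d₀)

      OccLR : ∀ {s} → Term F s → Term F s → Var F → ℕ → Set
      OccLR l r y a = Occ y l a ⊎ Occ y r a

      OccLR⇒∈ : ∀ {s} {l r : Term F s} {y a} → OccLR l r y a → y ∈ vars F l ++ vars F r
      OccLR⇒∈ (inj₁ occ) = ∈-++⁺ˡ (Occ⇒∈-vars occ)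
      OccLR⇒∈ {l = l} (inj₂ occ) = ∈-++⁺ʳ (vars F l) (Occ⇒∈-vars occ)

      DepthSpread : ∀ {s} → Term F s → Term F s → Set
      DepthSpread l r = ∀ {y a b} → OccLR l r y a → OccLR l r y b → a ≤ b + d₀

      PosShape : Pos F → Set
      PosShape p = Σ (List ℕ) λ ks → p ≡ ks ++ p₀ × length ks ≤ patternPosLength × All (_< arityBound) ks

      Bounded : PRule F → Set
      Bounded ⟨ l ⟶ r , p ⟩ = depth l ≤ depthBound p × depth r ≤ depthBound p × DepthSpread l r × PosShape p

      Bounded-start : Bounded ⟨ l₀ ⟶ r₀ , p₀ ⟩
      Bounded-start = ≤-trans (m≤m⊔n _ _) d₀≤ , ≤-trans (m≤n⊔m _ _) d₀≤ ,
                      (λ occ _ → ≤-trans (occ≤d₀ occ) (m≤n+m d₀ _)) , [] , refl , z≤n , []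
        where
          d₀≤ : d₀ ≤ depthBound p₀
          d₀≤ = ≤-trans (m≤n+m d₀ patternDepth) (m≤n+m _ (length p₀))
          occ≤d₀ : ∀ {y a} → OccLR l₀ r₀ y a → a ≤ d₀
          occ≤d₀ (inj₁ occ) = ≤-trans (Occ⇒≤depth occ) (m≤m⊔n _ _)
          occ≤d₀ (inj₂ occ) = ≤-trans (Occ⇒≤depth occ) (m≤n⊔m _ _)

      RV⇒shallow-occ : ∀ {s} (l : Term F s) p {x} → RV F Π l p x →
                       ∃ λ a → Occ x l a × suc a ≤ length p + patternDepth
      RV⇒shallow-occ l p {x} (x∈l , π , π∈Π , q , (_ , lq) , l∣q≡ , q++o≡p , θ , mgu , θx-nonvar) =
        length q + b , Occ-∣ l q l∣q≡ occ , bound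
        where
          u : Term F (Pattern.psort π)
          u = Pattern.u π
          lq-disjoint : ∀ {y} → y ∈ vars F lq → y ∉ vars F (apart F u l)
          lq-disjoint y∈lq =
            apart-disjoint u l (Occ⇒∈-vars (Occ-∣ l q l∣q≡ (proj₂ (∈-vars⇒Occ lq y∈lq))))
          occBelow : Skeleton.OccBelow x θ (apart F u l) lq
          occBelow = Skeleton.mgu-binds⇒occBelow x θ (apart F u l) lq (apart-linear u l (All.lookup linΠ π∈Π))
                       lq-disjoint (apart-disjoint u l x∈l) mgu θx-nonvar
          b : ℕ
          b = proj₁ occBelow
          occ : Occ x lq b
          occ = proj₁ (proj₂ occBelow)
          b<u : b < patternDepth
          b<u = ≤-trans (proj₂ (proj₂ occBelow)) (≤-trans (≤-reflexive (depth-ren u _)) (≤-max-map _ π∈Π))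
          q≤p : length q ≤ length p
          q≤p = ≤-trans (m≤m+n _ _) (≤-reflexive (trans (sym (length-++ q)) (cong length q++o≡p)))
          bound : suc (length q + b) ≤ length p + patternDepth
          bound = ≤-trans (≤-reflexive (sym (+-suc (length q) b))) (+-mono-≤ q≤p b<u)

      module Instantiation {s} (l r : Term F s) (x : Var F) (f : Fin nFuns) (nm : Fin (length (args f)) → ℕ)
        (σ : Subst F) (σx≅ : σ (proj₁ x) (proj₂ x) ≅ app (fun f) (varArgs F Π (args f) nm))
        (σ-id : ∀ s n → (s , n) ≢ x → σ s n ≡ var s n) where

        FreshName : Var F → Set
        FreshName y = Σ (Fin (length (args f))) λ j → y ≡ (lookup (args f) j , nm j)

        Occ-instantiate⁻ : ∀ {s′} (t : Term F s′) {y c} → Occ y (t ⟪ σ ⟫) c →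
                           (Σ ℕ λ a → Occ x t a × c ≡ suc a × FreshName y) ⊎ Occ y t c
        Occ-instantiate⁻ t occ with Occ-⟪⟫⁻ t occ
        ... | z , a , b , occ-t , occ-σz , c≡ with z ≟ᵛ x
        ...   | yes refl with subst (λ (_ , v) → Occ _ v b) σx≅ occ-σz
        ...     | in-app occ-args with Occs-varArgs⁻ (args f) nm occ-args
        ...       | refl , fresh = inj₁ (a , occ-t , trans c≡ (+-comm a 1) , fresh)
        Occ-instantiate⁻ t occ | (s′ , n) , a , b , occ-t , occ-σz , c≡ | no z≢x
          with Occ-var⁻ (subst (λ v → Occ _ v b) (σ-id s′ n z≢x) occ-σz)
        ... | refl , refl = inj₂ (subst (Occ _ t) (sym (trans c≡ (+-identityʳ a))) occ-t)

        depth-σx : depth (σ (proj₁ x) (proj₂ x)) ≡ 1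
        depth-σx = trans (cong (λ (_ , v) → depth v) σx≅) (cong suc (depths-varArgs (args f) nm))

        depth-instantiate-≤ : (t : Term F s) {K : ℕ} → depth t ≤ K → (∀ {a} → Occ x t a → suc a ≤ K) →
                              depth (t ⟪ σ ⟫) ≤ K
        depth-instantiate-≤ t {K} t≤ x-shallow = depth-⟪⟫-≤ t K t≤ bound
          where
            bound : ∀ {s′ n a} → Occ (s′ , n) t a → a + depth (σ s′ n) ≤ K
            bound {s′} {n} {a} occ with (s′ , n) ≟ᵛ x
            ... | yes refl = subst (λ d → a + d ≤ K) (sym depth-σx)
                               (≤-trans (≤-reflexive (+-comm a 1)) (x-shallow occ))
            ... | no y≢x = subst (λ v → a + depth v ≤ K) (sym (σ-id s′ n y≢x))
                             (≤-trans (≤-reflexive (+-identityʳ a)) (≤-trans (Occ⇒≤depth occ) t≤))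

        OccLR-instantiate⁻ : ∀ {y c} → OccLR (l ⟪ σ ⟫) (r ⟪ σ ⟫) y c →
                             (Σ ℕ λ a → OccLR l r x a × c ≡ suc a × FreshName y) ⊎ OccLR l r y c
        OccLR-instantiate⁻ (inj₁ occ) with Occ-instantiate⁻ l occ
        ... | inj₁ (a , occ′ , c≡ , new) = inj₁ (a , inj₁ occ′ , c≡ , new)
        ... | inj₂ occ′ = inj₂ (inj₁ occ′)
        OccLR-instantiate⁻ (inj₂ occ) with Occ-instantiate⁻ r occ
        ... | inj₁ (a , occ′ , c≡ , new) = inj₁ (a , inj₂ occ′ , c≡ , new)
        ... | inj₂ occ′ = inj₂ (inj₂ occ′)

        DepthSpread-instantiate : (∀ {y} → FreshName y → y ∉ vars F l ++ vars F r) →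
                                  DepthSpread l r → DepthSpread (l ⟪ σ ⟫) (r ⟪ σ ⟫)
        DepthSpread-instantiate fresh spread occ₁ occ₂ with OccLR-instantiate⁻ occ₁ | OccLR-instantiate⁻ occ₂
        ... | inj₁ (_ , x₁ , refl , _) | inj₁ (_ , x₂ , refl , _) = s≤s (spread x₁ x₂)
        ... | inj₂ old₁ | inj₂ old₂ = spread old₁ old₂
        ... | inj₁ (_ , _ , _ , new) | inj₂ old = ⊥-elim (fresh new (OccLR⇒∈ old))
        ... | inj₂ old | inj₁ (_ , _ , _ , new) = ⊥-elim (fresh new (OccLR⇒∈ old))

      Ti-preserves-Bounded : ∀ {ρ ρ′} → Ti F Π ρ ρ′ → Bounded ρ → Bounded ρ′
      Ti-preserves-Bounded {⟨ l ⟶ r , p ⟩} (x , rv , f , _ , nm , _ , fresh , σ , σx≅ , σ-id , refl)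
                           (l≤ , r≤ , spread , shape) =
        depth-instantiate-≤ l l≤ (λ occ → x-shallow (inj₁ occ)) ,
        depth-instantiate-≤ r r≤ (λ occ → x-shallow (inj₂ occ)) ,
        DepthSpread-instantiate (λ { (j , refl) → fresh j }) spread ,
        shape
        where
          open Instantiation l r x f nm σ σx≅ σ-id
          shallow : ∃ λ a → Occ x l a × suc a ≤ length p + patternDepth
          shallow = RV⇒shallow-occ l p rv
          x-shallow : ∀ {a} → OccLR l r x a → suc a ≤ depthBound p
          x-shallow {a} occ = begin
            suc a                              ≤⟨ s≤s (spread occ (inj₁ (proj₁ (proj₂ shallow)))) ⟩
            suc (proj₁ shallow) + d₀           ≤⟨ +-monoˡ-≤ d₀ (proj₂ (proj₂ shallow)) ⟩
            length p + patternDepth + d₀       ≡⟨ +-assoc (length p) patternDepth d₀ ⟩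
            depthBound p                       ∎
            where open ≤-Reasoning

      module Embedding (f : Sym F) (i : Fin (length (argsX F f))) (nm : Fin (length (argsX F f)) → ℕ)
        (l r : Term F (lookup (argsX F f) i)) where

        C : Term F (lookup (argsX F f) i) → Term F (resX F f)
        C t = app f (plug F Π (argsX F f) i nm t)

        ContextName : Var F → Set
        ContextName y = Σ (Fin (length (argsX F f))) λ j → j ≢ i × y ≡ (lookup (argsX F f) j , nm j)

        OccLR-embed⁻ : ∀ {y c} → OccLR (C l) (C r) y c →
                       (Σ ℕ λ a → OccLR l r y a × c ≡ suc a) ⊎ (ContextName y × c ≡ 1)
        OccLR-embed⁻ (inj₁ (in-app occ)) with Occs-plug⁻ (argsX F f) i nm l occ
        ... | inj₁ occ′ = inj₁ (_ , inj₁ occ′ , refl)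
        ... | inj₂ (j , j≢i , y≡ , refl) = inj₂ ((j , j≢i , y≡) , refl)
        OccLR-embed⁻ (inj₂ (in-app occ)) with Occs-plug⁻ (argsX F f) i nm r occ
        ... | inj₁ occ′ = inj₁ (_ , inj₂ occ′ , refl)
        ... | inj₂ (j , j≢i , y≡ , refl) = inj₂ ((j , j≢i , y≡) , refl)

        DepthSpread-embed : (∀ {y} → ContextName y → y ∉ vars F l ++ vars F r) →
                            DepthSpread l r → DepthSpread (C l) (C r)
        DepthSpread-embed fresh spread occ₁ occ₂ with OccLR-embed⁻ occ₁ | OccLR-embed⁻ occ₂
        ... | inj₁ (_ , old₁ , refl) | inj₁ (_ , old₂ , refl) = s≤s (spread old₁ old₂)
        ... | inj₂ (_ , refl) | inj₂ (_ , refl) = s≤s z≤n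
        ... | inj₂ (new , _) | inj₁ (_ , old , _) = ⊥-elim (fresh new (OccLR⇒∈ old))
        ... | inj₁ (_ , old , _) | inj₂ (new , _) = ⊥-elim (fresh new (OccLR⇒∈ old))

        depth-embed-≤ : ∀ t {K} → depth t ≤ K → depth (C t) ≤ suc K
        depth-embed-≤ t t≤ = s≤s (≤-trans (depths-plug-≤ (argsX F f) i nm t) t≤)

      PosShape-∷ : ∀ {p} π q → π ∈ Π → q ≢ [] → Pattern.o π ≡ q ++ p →
                   ∀ {k} → k < arityBound → PosShape p → PosShape (k ∷ p)
      PosShape-∷ {p} π [] _ q≢[] _ _ _ = ⊥-elim (q≢[] refl)
      PosShape-∷ {p} π (c ∷ q) π∈Π _ o≡ {k} k< (ks , p≡ , ks≤ , ks<) =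
        k ∷ ks , cong (k ∷_) p≡ , k∷ks≤ , k< ∷ ks<
        where
          open ≤-Reasoning
          k∷ks≤ : suc (length ks) ≤ patternPosLength
          k∷ks≤ = begin
            suc (length ks)              ≤⟨ s≤s (m≤m+n (length ks) (length p₀)) ⟩
            suc (length ks + length p₀)  ≡⟨ cong suc (trans (sym (length-++ ks)) (cong length (sym p≡))) ⟩
            suc (length p)               ≤⟨ s≤s (m≤n+m (length p) (length q)) ⟩
            suc (length q + length p)    ≡⟨ cong suc (sym (length-++ q)) ⟩
            length (c ∷ q ++ p)          ≡⟨ cong length (sym o≡) ⟩
            length (Pattern.o π)         ≤⟨ ≤-max-map (λ π → length (Pattern.o π)) π∈Π ⟩
            patternPosLength             ∎

      Te-preserves-Bounded : ∀ {ρ ρ′} → Te F Π ρ ρ′ → Bounded ρ → Bounded ρ′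
      Te-preserves-Bounded {⟨ l ⟶ r , p ⟩}
                           ((π , π∈Π , q , q≢[] , _ , _ , _ , _ , o≡) , f , i , refl , nm , _ , fresh , refl)
                           (l≤ , r≤ , spread , shape) =
        depth-embed-≤ l l≤ , depth-embed-≤ r r≤ ,
        DepthSpread-embed (λ (j , j≢i , y≡) → subst (_∉ _) (sym y≡) (fresh j j≢i)) spread ,
        PosShape-∷ π q π∈Π q≢[] o≡ (<-trans (toℕ<n i) (arity<arityBound f)) shape
        where open Embedding f i nm l r

      TStar-preserves-Bounded : ∀ {ρ ρ′} → TStar F Π ρ ρ′ → Bounded ρ → Bounded ρ′
      TStar-preserves-Bounded ε bounded = bounded
      TStar-preserves-Bounded (inj₁ ti ◅ steps) bounded = TStar-preserves-Bounded steps (Ti-preserves-Bounded ti bounded)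
      TStar-preserves-Bounded (inj₂ te ◅ steps) bounded = TStar-preserves-Bounded steps (Te-preserves-Bounded te bounded)

      length-vars≤ : ∀ {s} (t : Term F s) → length (vars F t) ≤ arityBound ^ depth t
      length-varsS≤ : ∀ {ss} (ts : Terms F ss) → length (varsS F ts) ≤ length ss * arityBound ^ depths ts
      length-vars≤ (var s n) = s≤s z≤n
      length-vars≤ (app f ts) =
        ≤-trans (length-varsS≤ ts) (*-monoˡ-≤ (arityBound ^ depths ts) (<⇒≤ (arity<arityBound f)))
      length-varsS≤ [] = z≤n
      length-varsS≤ {s ∷ ss} (t ∷ ts) = ≤-trans (≤-reflexive (length-++ (vars F t)))
        (+-mono-≤ (≤-trans (length-vars≤ t) (^-monoʳ-≤ arityBound (m≤m⊔n (depth t) (depths ts))))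
                  (≤-trans (length-varsS≤ ts)
                           (*-monoʳ-≤ (length ss) (^-monoʳ-≤ arityBound (m≤n⊔m (depth t) (depths ts))))))

      maxDepth nameBound : ℕ
      maxDepth = (patternPosLength + length p₀) + (patternDepth + d₀)
      nameBound = arityBound ^ maxDepth + arityBound ^ maxDepth

      depthBound≤maxDepth : ∀ {p} → PosShape p → depthBound p ≤ maxDepth
      depthBound≤maxDepth (ks , refl , ks≤ , _) =
        +-monoˡ-≤ (patternDepth + d₀) (≤-trans (≤-reflexive (length-++ ks)) (+-monoˡ-≤ (length p₀) ks≤))

      open Enumeration nameBound

      candidates : List (PRule F)
      candidates =
        concatMap (λ s → concatMap (λ l → concatMap (λ r →
          map (λ ks → ⟨ l ⟶ r , ks ++ p₀ ⟩) (lists-below arityBound patternPosLength))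
          (terms maxDepth s)) (terms maxDepth s)) (allFin nSorts)

      Bounded⇒variant-of-candidate : ∀ ρ → Bounded ρ →
                                     Σ (PRule F) λ ρ′ → ρ′ ∈ candidates × Variant F ρ ρ′
      Bounded⇒variant-of-candidate (⟨_⟶_,_⟩ {s} l r p) (l≤ , r≤ , _ , shape@(ks , p≡ , ks≤ , ks<)) =
        ⟨ l ⟪ ren ρ ⟫ ⟶ r ⟪ ren ρ ⟫ , ks ++ p₀ ⟩ , ∈-candidates ,
        ρ , (λ _ → Inverse.from π) , (λ _ → Inverse.strictlyInverseʳ π) , (λ _ → Inverse.strictlyInverseˡ π) ,
        refl , refl , p≡
        where
          names : List ℕ
          names = map proj₂ (vars F l ++ vars F r)
          π : ℕ ↔ ℕ
          π = proj₁ (compress-names names)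
          ρ : Renaming
          ρ _ = Inverse.to π
          open ≤-Reasoning
          length-names≤ : length names ≤ nameBound
          length-names≤ = begin
            length names                              ≡⟨ length-map proj₂ (vars F l ++ vars F r) ⟩
            length (vars F l ++ vars F r)             ≡⟨ length-++ (vars F l) ⟩
            length (vars F l) + length (vars F r)     ≤⟨ +-mono-≤ (vars≤ l l≤) (vars≤ r r≤) ⟩
            nameBound                                 ∎
            where
              vars≤ : ∀ t → depth t ≤ depthBound p → length (vars F t) ≤ arityBound ^ maxDepth
              vars≤ t t≤ =
                ≤-trans (length-vars≤ t) (^-monoʳ-≤ arityBound (≤-trans t≤ (depthBound≤maxDepth shape)))
          renamed∈terms : ∀ t → depth t ≤ depthBound p →
                          (∀ {y} → y ∈ vars F t → y ∈ vars F l ++ vars F r) →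
                          t ⟪ ren ρ ⟫ ∈ terms maxDepth s
          renamed∈terms t t≤ t⊆ = ∈-terms maxDepth (t ⟪ ren ρ ⟫)
            (≤-trans (≤-reflexive (depth-ren t ρ)) (≤-trans t≤ (depthBound≤maxDepth shape)))
            names<
            where
              names< : NamesBelow (t ⟪ ren ρ ⟫)
              names< occ with Occ-⟪⟫⁻ t occ
              ... | _ , _ , _ , occ-t , at-var , _ =
                <-≤-trans (proj₂ (compress-names names) (∈-map⁺ proj₂ (t⊆ (Occ⇒∈-vars occ-t))))
                          length-names≤
          ∈-candidates : ⟨ l ⟪ ren ρ ⟫ ⟶ r ⟪ ren ρ ⟫ , ks ++ p₀ ⟩ ∈ candidates
          ∈-candidates =
            ∈-concatMap-intro (∈-allFin s) (∈-concatMap-intro (renamed∈terms l l≤ ∈-++⁺ˡ)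
              (∈-concatMap-intro (renamed∈terms r r≤ (∈-++⁺ʳ (vars F l)))
                (∈-map⁺ (λ ks → ⟨ _ ⟶ _ , ks ++ p₀ ⟩) (∈-lists-below arityBound patternPosLength ks ks≤ ks<))))

lemma18 : (F : Signature) (Π : List (Pattern F)) →
          All (WFPattern F) Π → All (LinearPattern F) Π →
          (ρ : PRule F) → IsRewriteRule F ρ →
          FiniteUpToRenaming F (TStar F Π ρ)
lemma18 F Π _ linΠ ⟨ l₀ ⟶ r₀ , p₀ ⟩ _ =
  candidates , λ ρ steps → Bounded⇒variant-of-candidate ρ (TStar-preserves-Bounded steps Bounded-start)
  where open Bounds F Π linΠ l₀ r₀ p₀
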